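{- Let $B$ be a binary string with $|B|\geq 2$ and let $T=T(B)$. A set $S\subseteq V(T)$ is a zero forcing set of $T$ if and only if (1) $S$ excludes at most one vertex from each block of $B$, and (2) between any two 1-vertices not in $S$ (in the order of positions of $B$), there is a 0-vertex in $S$.
   Context: For a binary string $B=b_1b_2\cdots b_n$, the threshold graph $T(B)$ has vertex set the positions $1,\ldots,n$ of $B$, with positions $p<q$ adjacent if and only if $b_q=1$. Standing assumptions: the first two symbols of $B$ are equal ($b_1=b_2$), and the last symbol is $1$ (so $T(B)$ is connected). A block of $B$ is a maximal contiguous substring consisting only of 0s or only of 1s; a vertex at a position with symbol $1$ (resp. $0$) is a 1-vertex (resp. 0-vertex). Zero forcing: given a set of colored vertices, a colored vertex $u$ with exactly one uncolored neighbor $v$ may force $v$ to become colored; $S$ is a zero forcing set if starting with $S$ colored and repeatedly applying this rule colors all vertices. -}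

module Defs where

open import Data.Nat using (ℕ)
open import Data.Bool using (Bool; true; false)
open import Data.Fin using (Fin; _<_; _≤_)
open import Data.Fin.Subset using (Subset; _∈_; _∉_)
open import Data.Product using (_×_; ∃-syntax)
open import Data.Sum using (_⊎_)
open import Data.Empty using (⊥)
open import Relation.Binary.PropositionalEquality using (_≡_; _≢_)

-- A binary string of length n: positions are Fin n, symbol true = 1, false = 0.
BinStr : ℕ → Set
BinStr n = Fin n → Bool

Adj : ∀ {n} → BinStr n → Fin n → Fin n → Set
Adj B p q = (p < q × B q ≡ true) ⊎ (q < p × B p ≡ true)

-- A colored u whose only uncolored neighbour is v forces v.  Since the rule is
-- monotone, the final colored set is the least set containing S closed under it.
data Colored {n} (B : BinStr n) (S : Subset n) : Fin n → Set where
  init  : ∀ {v} → v ∈ S → Colored B S v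
  force : ∀ {u v} → Colored B S u → Adj B u v →
          (∀ w → Adj B u w → w ≢ v → Colored B S w) →
          Colored B S v

IsZeroForcingSet : ∀ {n} → BinStr n → Subset n → Set
IsZeroForcingSet B S = ∀ v → Colored B S v

SameBlock : ∀ {n} → BinStr n → Fin n → Fin n → Set
SameBlock B i j = ∀ k → i ≤ k → k ≤ j → B k ≡ B i

ExcludesAtMostOnePerBlock : ∀ {n} → BinStr n → Subset n → Set
ExcludesAtMostOnePerBlock B S =
  ∀ i j → i < j → SameBlock B i j → i ∉ S → j ∉ S → ⊥

ZeroBetweenUncoloredOnes : ∀ {n} → BinStr n → Subset n → Set
ZeroBetweenUncoloredOnes B S =
  ∀ p q → p < q → B p ≡ true → B q ≡ true → p ∉ S → q ∉ S →
  ∃[ k ] (p < k × k < q × B k ≡ false × k ∈ S)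

module Submission where

-- Necessity goes through forts: a fort is a set F of vertices such that no
-- vertex outside F has exactly one neighbour in F.  A fort disjoint from S is
-- never entered by forcing, so every zero forcing set meets every fort.  Two
-- excluded positions of one block are twins and form a fort, which gives (1);
-- two excluded 1-vertices p < q together with the 0-vertices strictly between
-- them form a fort, which is disjoint from S exactly when (2) fails for p, q.
--
-- Sufficiency exhibits forcers.  The 1-vertices are colored from right to
-- left: an excluded 1-vertex q is forced by the nearest 0-vertex of S below it,
-- or, if there is none, by a vertex of S in the first block, which then must
-- be a block of 1s.  The 0-vertices are then colored from left to right: an
-- excluded 0-vertex x is forced by the first 1-vertex after x, since the other
-- 0-vertices up to it lie in the block of x and hence belong to S by (1).

open import Defs
open import Data.Nat using (ℕ; suc; s≤s; z≤n)
import Data.Nat.Properties as ℕ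
open import Data.Bool using (true; false)
open import Data.Bool.Properties using () renaming (_≟_ to _≟ᴮ_)
open import Data.Fin using (Fin; zero; suc; fromℕ; _<_; _≤_; _>_)
open import Data.Fin.Subset using (Subset; _∈_; _∉_)
open import Data.Fin.Subset.Properties using (_∈?_)
open import Data.Fin.Properties using (_≟_; _<?_; <-cmp; <-trans; <⇒≢; ≤∧≢⇒<; ≤fromℕ; any?)
open import Data.Fin.Induction using (<-wellFounded; >-wellFounded)
open import Induction.WellFounded using (WellFounded; Acc; acc)
open import Data.Product using (_×_; _,_; proj₁; ∃-syntax)
open import Data.Sum using (_⊎_; inj₁; inj₂)
open import Data.Empty using (⊥-elim)
open import Function using (_∘_)
open import Level using (0ℓ)
open import Relation.Nullary using (¬_; yes; no)
open import Relation.Nullary.Decidable using (_×-dec_)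
open import Relation.Unary using (Pred) renaming (Decidable to Decidable₁)
open import Relation.Binary using (Rel; Decidable; tri<; tri≈; tri>)
open import Relation.Binary.PropositionalEquality using (_≡_; _≢_; refl; sym; trans)

minimalWitness : ∀ {n} {_≺_ : Rel (Fin n) 0ℓ} → WellFounded _≺_ → Decidable _≺_ →
                 {P : Pred (Fin n) 0ℓ} → Decidable₁ P → ∀ {x} → P x →
                 ∃[ z ] (P z × (∀ {w} → w ≺ z → ¬ P w))
minimalWitness {_≺_ = _≺_} wf _≺?_ {P} P? {x} = descend x (wf x)
  where
  descend : ∀ x → Acc _≺_ x → P x → ∃[ z ] (P z × (∀ {w} → w ≺ z → ¬ P w))
  descend x (acc smaller) px with any? (λ w → (w ≺? x) ×-dec P? w)
  ... | yes (w , w≺x , pw) = descend w (smaller w≺x) pw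
  ... | no noSmaller = x , px , λ w≺x pw → noSmaller (_ , w≺x , pw)

module ThresholdGraph {n : ℕ} {B : BinStr n} where

  onesAreNotZeros : ∀ {u v} → B u ≡ true → B v ≡ false → u ≢ v
  onesAreNotZeros Bu Bv refl with trans (sym Bu) Bv
  ... | ()

  symbolOf : ∀ u → B u ≡ true ⊎ B u ≡ false
  symbolOf u with B u
  ... | true = inj₁ refl
  ... | false = inj₂ refl

  adjSym : ∀ {u v} → Adj B u v → Adj B v u
  adjSym (inj₁ edge) = inj₂ edge
  adjSym (inj₂ edge) = inj₁ edge

  onesAdjacent : ∀ {u v} → B u ≡ true → B v ≡ true → u ≢ v → Adj B u v
  onesAdjacent {u} {v} Bu Bv u≢v with <-cmp u v
  ... | tri< u<v _ _ = inj₁ (u<v , Bv)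
  ... | tri≈ _ u≡v _ = ⊥-elim (u≢v u≡v)
  ... | tri> _ _ v<u = inj₂ (v<u , Bu)

  neighbourOfZero : ∀ {u v} → B u ≡ false → Adj B u v → u < v × B v ≡ true
  neighbourOfZero Bu (inj₁ edge) = edge
  neighbourOfZero Bu (inj₂ (_ , Bu′)) = ⊥-elim (onesAreNotZeros Bu′ Bu refl)

  module _ {i j : Fin n} (i<j : i < j) (block : SameBlock B i j) where

    private
      Bj≡Bi : B j ≡ B i
      Bj≡Bi = block j (ℕ.<⇒≤ i<j) ℕ.≤-refl

    sameBlockTwinʳ : ∀ {u} → u ≢ i → u ≢ j → Adj B u i → Adj B u j
    sameBlockTwinʳ u≢i u≢j (inj₁ (u<i , Bi)) = inj₁ (<-trans u<i i<j , trans Bj≡Bi Bi)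
    sameBlockTwinʳ {u} u≢i u≢j (inj₂ (i<u , Bu)) with <-cmp u j
    ... | tri< u<j _ _ =
      inj₁ (u<j , trans Bj≡Bi (trans (sym (block u (ℕ.<⇒≤ i<u) (ℕ.<⇒≤ u<j))) Bu))
    ... | tri≈ _ u≡j _ = ⊥-elim (u≢j u≡j)
    ... | tri> _ _ j<u = inj₂ (j<u , Bu)

    sameBlockTwinˡ : ∀ {u} → u ≢ i → u ≢ j → Adj B u j → Adj B u i
    sameBlockTwinˡ {u} u≢i u≢j (inj₁ (u<j , Bj)) with <-cmp u i
    ... | tri< u<i _ _ = inj₁ (u<i , trans (sym Bj≡Bi) Bj)
    ... | tri≈ _ u≡i _ = ⊥-elim (u≢i u≡i)
    ... | tri> _ _ i<u =
      inj₂ (i<u , trans (block u (ℕ.<⇒≤ i<u) (ℕ.<⇒≤ u<j)) (trans (sym Bj≡Bi) Bj))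
    sameBlockTwinˡ u≢i u≢j (inj₂ (j<u , Bu)) = inj₂ (<-trans i<j j<u , Bu)

  IsFort : Pred (Fin n) 0ℓ → Set
  IsFort F = ∀ {u v} → ¬ F u → F v → Adj B u v → ∃[ w ] (F w × w ≢ v × Adj B u w)

  -- Forcing never colors a vertex of a fort disjoint from the initial set:
  -- a forcing vertex outside the fort sees a second, still uncolored, fort vertex.
  fortNeverColored : ∀ {S F} → IsFort F → (∀ {v} → v ∈ S → ¬ F v) →
                     ∀ {v} → Colored B S v → ¬ F v
  fortNeverColored fort disjoint (init v∈S) = disjoint v∈S
  fortNeverColored fort disjoint (force colored edge othersColored) Fv
    with fort (fortNeverColored fort disjoint colored) Fv edge
  ... | w , Fw , w≢v , edgeToW = fortNeverColored fort disjoint (othersColored w edgeToW w≢v) Fw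

  otherOfPair : ∀ {u a b} → a ≢ b → Adj B u a → Adj B u b →
                ∀ v → ∃[ w ] ((w ≡ a ⊎ w ≡ b) × w ≢ v × Adj B u w)
  otherOfPair {a = a} {b} a≢b u∼a u∼b v with a ≟ v
  ... | yes refl = b , inj₂ refl , (λ b≡a → a≢b (sym b≡a)) , u∼b
  ... | no a≢v = a , inj₁ refl , a≢v , u∼a

  twinFort : ∀ {i j} → i < j → SameBlock B i j → IsFort (λ v → v ≡ i ⊎ v ≡ j)
  twinFort i<j block ¬Fu (inj₁ refl) u∼i =
    otherOfPair (<⇒≢ i<j) u∼i (sameBlockTwinʳ i<j block (¬Fu ∘ inj₁) (¬Fu ∘ inj₂) u∼i) _
  twinFort i<j block ¬Fu (inj₂ refl) u∼j =
    otherOfPair (<⇒≢ i<j) (sameBlockTwinˡ i<j block (¬Fu ∘ inj₁) (¬Fu ∘ inj₂) u∼j) u∼j _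

  Gap : Fin n → Fin n → Pred (Fin n) 0ℓ
  Gap p q v = (v ≡ p ⊎ v ≡ q) ⊎ (p < v × v < q × B v ≡ false)

  gapAtMost : ∀ {p q v} → p < q → Gap p q v → v ≤ q
  gapAtMost p<q (inj₁ (inj₁ refl)) = ℕ.<⇒≤ p<q
  gapAtMost p<q (inj₁ (inj₂ refl)) = ℕ.≤-refl
  gapAtMost p<q (inj₂ (_ , v<q , _)) = ℕ.<⇒≤ v<q

  inGap : ∀ {u v p q} → ∃[ w ] ((w ≡ p ⊎ w ≡ q) × w ≢ v × Adj B u w) →
          ∃[ w ] (Gap p q w × w ≢ v × Adj B u w)
  inGap (w , endpoint , w≢v , u∼w) = w , inj₁ endpoint , w≢v , u∼w

  -- The gap between two 1-vertices is a fort: a vertex outside it is either a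
  -- 1-vertex or lies before p, and then sees both p and q, or it is a 0-vertex
  -- after q, and then sees nothing of the gap.
  gapFort : ∀ {p q} → p < q → B p ≡ true → B q ≡ true → IsFort (Gap p q)
  gapFort {p} {q} p<q Bp Bq {u} {v} ¬Fu Fv u∼v with <-cmp u p
  ... | tri< u<p _ _ =
    inGap (otherOfPair (<⇒≢ p<q) (inj₁ (u<p , Bp)) (inj₁ (<-trans u<p p<q , Bq)) v)
  ... | tri≈ _ u≡p _ = ⊥-elim (¬Fu (inj₁ (inj₁ u≡p)))
  ... | tri> _ _ p<u with symbolOf u
  ...   | inj₁ Bu = inGap (otherOfPair (<⇒≢ p<q) (onesAdjacent Bu Bp (¬Fu ∘ inj₁ ∘ inj₁))
                                              (onesAdjacent Bu Bq (¬Fu ∘ inj₁ ∘ inj₂)) v)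
  ...   | inj₂ Bu with <-cmp u q
  ...     | tri< u<q _ _ = ⊥-elim (¬Fu (inj₂ (p<u , u<q , Bu)))
  ...     | tri≈ _ u≡q _ = ⊥-elim (¬Fu (inj₁ (inj₂ u≡q)))
  ...     | tri> _ _ q<u = -- u's neighbour v lies after u > q, outside the gap
                           ⊥-elim (ℕ.<-irrefl refl
                              (ℕ.<-≤-trans (<-trans q<u (proj₁ (neighbourOfZero Bu u∼v)))
                                           (gapAtMost p<q Fv)))

  excludesAtMostOne : ∀ {S} → IsZeroForcingSet B S → ExcludesAtMostOnePerBlock B S
  excludesAtMostOne {S} zf i j i<j block i∉S j∉S =
    fortNeverColored (twinFort i<j block) disjoint (zf i) (inj₁ refl)
    where
    disjoint : ∀ {v} → v ∈ S → ¬ (v ≡ i ⊎ v ≡ j)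
    disjoint v∈S (inj₁ refl) = i∉S v∈S
    disjoint v∈S (inj₂ refl) = j∉S v∈S

  zeroBetweenOnes : ∀ {S} → IsZeroForcingSet B S → ZeroBetweenUncoloredOnes B S
  zeroBetweenOnes {S} zf p q p<q Bp Bq p∉S q∉S
    with any? (λ k → (p <? k) ×-dec (k <? q) ×-dec (B k ≟ᴮ false) ×-dec (k ∈? S))
  ... | yes separator = separator
  ... | no noSeparator =
    ⊥-elim (fortNeverColored (gapFort p<q Bp Bq) disjoint (zf p) (inj₁ (inj₁ refl)))
    where
    disjoint : ∀ {v} → v ∈ S → ¬ Gap p q v
    disjoint v∈S (inj₁ (inj₁ refl)) = p∉S v∈S
    disjoint v∈S (inj₁ (inj₂ refl)) = q∉S v∈S
    disjoint {v} v∈S (inj₂ (p<v , v<q , Bv)) = noSeparator (v , p<v , v<q , Bv , v∈S)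

module Sufficiency {m : ℕ} (B : BinStr (suc (suc m))) (S : Subset (suc (suc m)))
                   (firstTwoEqual : B zero ≡ B (suc zero))
                   (atMostOne : ExcludesAtMostOnePerBlock B S)
                   (separated : ZeroBetweenUncoloredOnes B S) where

  open ThresholdGraph {B = B}

  ZeroOfSBelow : Fin (suc (suc m)) → Pred (Fin (suc (suc m))) 0ℓ
  ZeroOfSBelow q z = z < q × B z ≡ false × z ∈ S

  zeroOfSBelow? : ∀ q → Decidable₁ (ZeroOfSBelow q)
  zeroOfSBelow? q z = (z <? q) ×-dec (B z ≟ᴮ false) ×-dec (z ∈? S)

  lowerOne : ∀ {q w} → q ∉ S → B q ≡ true → w < q → B w ≡ true →
             w ∈ S ⊎ ∃[ k ] (w < k × ZeroOfSBelow q k)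
  lowerOne {q} {w} q∉S Bq w<q Bw with w ∈? S
  ... | yes w∈S = inj₁ w∈S
  ... | no w∉S with separated w q w<q Bw Bq w∉S q∉S
  ...   | k , w<k , k<q , Bk , k∈S = inj₂ (k , w<k , k<q , Bk , k∈S)

  firstBlockMeetsS : ∃[ c ] (c ∈ S × (∀ w → w ≤ c → B w ≡ B c))
  firstBlockMeetsS with zero ∈? S
  ... | yes 0∈S = zero , 0∈S , λ { zero _ → refl }
  ... | no 0∉S with suc zero ∈? S
  ...   | yes 1∈S = suc zero , 1∈S , λ { zero _ → firstTwoEqual ; (suc zero) _ → refl
                                       ; (suc (suc _)) (s≤s ()) }
  ...   | no 1∉S = ⊥-elim (atMostOne zero (suc zero) (s≤s z≤n) firstTwoSameBlock 0∉S 1∉S)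
    where
    firstTwoSameBlock : SameBlock B zero (suc zero)
    firstTwoSameBlock zero _ _ = refl
    firstTwoSameBlock (suc zero) _ _ = sym firstTwoEqual
    firstTwoSameBlock (suc (suc _)) _ (s≤s ())

  HigherOnesColored : Fin (suc (suc m)) → Set
  HigherOnesColored q = ∀ w → q < w → B w ≡ true → Colored B S w

  -- The nearest 0-vertex z ∈ S below q forces q: its other neighbours are
  -- 1-vertices above q, or 1-vertices below q, which lie in S by (2) and the
  -- choice of z.
  nearestZeroForces : ∀ {q z} → q ∉ S → B q ≡ true → HigherOnesColored q →
                      ZeroOfSBelow q z → (∀ {w} → z < w → ¬ ZeroOfSBelow q w) →
                      Colored B S q
  nearestZeroForces {q} {z} q∉S Bq higher (z<q , Bz , z∈S) nearest =
    force (init z∈S) (inj₁ (z<q , Bq)) othersColored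
    where
    othersColored : ∀ w → Adj B z w → w ≢ q → Colored B S w
    othersColored w z∼w w≢q with neighbourOfZero Bz z∼w
    ... | z<w , Bw with <-cmp w q
    ...   | tri> _ _ q<w = higher w q<w Bw
    ...   | tri≈ _ w≡q _ = ⊥-elim (w≢q w≡q)
    ...   | tri< w<q _ _ with lowerOne q∉S Bq w<q Bw
    ...     | inj₁ w∈S = init w∈S
    ...     | inj₂ (k , w<k , zeroK) = ⊥-elim (nearest (<-trans z<w w<k) zeroK)

  -- Without 0-vertices of S below q, the vertex c ∈ S of the first block is a
  -- 1-vertex, all its neighbours are 1-vertices, and those below q lie in S.
  firstBlockForces : ∀ {q} → q ∉ S → B q ≡ true → HigherOnesColored q →
                     ¬ (∃[ z ] ZeroOfSBelow q z) → Colored B S q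
  firstBlockForces {q} q∉S Bq higher noZero with firstBlockMeetsS
  ... | c , c∈S , blockOfC with symbolOf c
  ...   | inj₂ Bc = ⊥-elim (noZero (c , belowQ , Bc , c∈S))
    where
    belowQ : c < q
    belowQ with <-cmp c q
    ... | tri< c<q _ _ = c<q
    ... | tri≈ _ c≡q _ = ⊥-elim (onesAreNotZeros Bq Bc (sym c≡q))
    ... | tri> _ _ q<c = ⊥-elim (onesAreNotZeros Bq (trans (blockOfC q (ℕ.<⇒≤ q<c)) Bc) refl)
  ...   | inj₁ Bc = force (init c∈S) (onesAdjacent Bc Bq (λ { refl → q∉S c∈S })) othersColored
    where
    neighbourIsOne : ∀ {w} → Adj B c w → B w ≡ true
    neighbourIsOne (inj₁ (_ , Bw)) = Bw
    neighbourIsOne (inj₂ (w<c , _)) = trans (blockOfC _ (ℕ.<⇒≤ w<c)) Bc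
    othersColored : ∀ w → Adj B c w → w ≢ q → Colored B S w
    othersColored w c∼w w≢q with <-cmp w q
    ... | tri> _ _ q<w = higher w q<w (neighbourIsOne c∼w)
    ... | tri≈ _ w≡q _ = ⊥-elim (w≢q w≡q)
    ... | tri< w<q _ _ with lowerOne q∉S Bq w<q (neighbourIsOne c∼w)
    ...   | inj₁ w∈S = init w∈S
    ...   | inj₂ (k , _ , zeroK) = ⊥-elim (noZero (k , zeroK))

  oneForced : ∀ {q} → B q ≡ true → HigherOnesColored q → Colored B S q
  oneForced {q} Bq higher with q ∈? S | any? (zeroOfSBelow? q)
  ... | yes q∈S | _ = init q∈S
  ... | no q∉S | no noZero = firstBlockForces q∉S Bq higher noZero
  ... | no q∉S | yes (_ , zeroZ)
    with minimalWitness >-wellFounded (λ x y → y <? x) (zeroOfSBelow? q) zeroZ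
  ...   | _ , nearestZero , nearest = nearestZeroForces q∉S Bq higher nearestZero nearest

  oneColoredFrom : ∀ q → Acc _>_ q → B q ≡ true → Colored B S q
  oneColoredFrom q (acc higherAcc) Bq =
    oneForced Bq (λ w q<w Bw → oneColoredFrom w (higherAcc q<w) Bw)

  oneColored : ∀ q → B q ≡ true → Colored B S q
  oneColored q = oneColoredFrom q (>-wellFounded q)

  -- An excluded 0-vertex x whose predecessors are colored is forced by the
  -- first 1-vertex y after x: the 0-vertices between x and y share the block of
  -- x and so lie in S by (1).
  nextOneForces : ∀ {x y} → B x ≡ false → x ∉ S → (∀ w → w < x → Colored B S w) →
                  x < y → B y ≡ true → (∀ {w} → w < y → ¬ (x < w × B w ≡ true)) →
                  Colored B S x
  nextOneForces {x} {y} Bx x∉S lowerColored x<y By first =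
    force (oneColored y By) (inj₂ (x<y , By)) othersColored
    where
    blockUpTo : ∀ {w} → w < y → SameBlock B x w
    blockUpTo w<y k x≤k k≤w with symbolOf k
    ... | inj₂ Bk = trans Bk (sym Bx)
    ... | inj₁ Bk = ⊥-elim (first (ℕ.≤-<-trans k≤w w<y)
                               (≤∧≢⇒< x≤k (λ x≡k → onesAreNotZeros Bk Bx (sym x≡k)) , Bk))
    othersColored : ∀ w → Adj B y w → w ≢ x → Colored B S w
    othersColored w y∼w w≢x with symbolOf w
    ... | inj₁ Bw = oneColored w Bw
    ... | inj₂ Bw with <-cmp w x
    ...   | tri< w<x _ _ = lowerColored w w<x
    ...   | tri≈ _ w≡x _ = ⊥-elim (w≢x w≡x)
    ...   | tri> _ _ x<w with w ∈? S
    ...     | yes w∈S = init w∈S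
    ...     | no w∉S = ⊥-elim (atMostOne x w x<w (blockUpTo w<y) x∉S w∉S)
      where
      w<y : w < y
      w<y = proj₁ (neighbourOfZero Bw (adjSym y∼w))

  beforeLast : ∀ {x} → B (fromℕ (suc m)) ≡ true → B x ≡ false → x < fromℕ (suc m)
  beforeLast {x} lastOne Bx = ≤∧≢⇒< (≤fromℕ x) (λ x≡last → onesAreNotZeros lastOne Bx (sym x≡last))

  -- Every vertex is colored, by upward induction; the last symbol being 1
  -- guarantees a 1-vertex after every 0-vertex.
  allColoredFrom : B (fromℕ (suc m)) ≡ true → ∀ x → Acc _<_ x → Colored B S x
  allColoredFrom lastOne x (acc lowerAcc) with symbolOf x | x ∈? S
  ... | inj₁ Bx | _ = oneColored x Bx
  ... | inj₂ Bx | yes x∈S = init x∈S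
  ... | inj₂ Bx | no x∉S
    with minimalWitness <-wellFounded _<?_ (λ y → (x <? y) ×-dec (B y ≟ᴮ true))
                        (beforeLast lastOne Bx , lastOne)
  ...   | _ , (x<y , By) , first =
    nextOneForces Bx x∉S (λ w w<x → allColoredFrom lastOne w (lowerAcc w<x)) x<y By first

  isZeroForcing : B (fromℕ (suc m)) ≡ true → IsZeroForcingSet B S
  isZeroForcing lastOne v = allColoredFrom lastOne v (<-wellFounded v)

open ThresholdGraph using (excludesAtMostOne; zeroBetweenOnes)

theorem4p8 : (m : ℕ) (B : BinStr (suc (suc m))) →
    B zero ≡ B (suc zero) → B (fromℕ (suc m)) ≡ true →
    (S : Subset (suc (suc m))) →
    (IsZeroForcingSet B S → ExcludesAtMostOnePerBlock B S × ZeroBetweenUncoloredOnes B S)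
    × (ExcludesAtMostOnePerBlock B S × ZeroBetweenUncoloredOnes B S → IsZeroForcingSet B S)
theorem4p8 m B firstTwoEqual lastOne S =
  (λ zf → excludesAtMostOne zf , zeroBetweenOnes zf) ,
  (λ { (atMostOne , separated) →
         Sufficiency.isZeroForcing B S firstTwoEqual atMostOne separated lastOne })
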